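{- Let $n\ge 2$ and let $f$ be a nested canalizing function on $n$ variables with layer structure $\langle k_1,\dots,k_r\rangle$. If $k_j\ge 3$ for some $j$, then $f$ is partially symmetric. Moreover, if $f$ is $s$-symmetric, then $\lceil s/2\rceil\le r\le \min\{n-1,s\}$.
   Context: $\oplus$ is addition modulo 2. A Boolean function $f:\mathbb{F}_2^n\to\mathbb{F}_2$ is nested canalizing (NCF) if for some permutation $\sigma$ of $\{1,\dots,n\}$ and $a_i,b_i\in\mathbb{F}_2$: $f=b_1$ if $x_{\sigma(1)}=a_1$; $f=b_k$ if $x_{\sigma(i)}=a_i\oplus1$ for $i<k$ and $x_{\sigma(k)}=a_k$ ($k\le n$); and $f=b_n\oplus 1$ if $x_{\sigma(i)}=a_i\oplus 1$ for all $i$. It is known that for $n\ge 2$ every NCF can be uniquely written as $f=M_1(M_2(\cdots(M_{r-1}(M_r\oplus1)\oplus1)\cdots)\oplus1)\oplus b$ with $M_i=\prod_{j=1}^{k_i}(x_{i_j}\oplus a_{i_j})$, $k_i\ge1$ for $i<r$, $k_r\ge2$, $k_1+\cdots+k_r=n$, each variable appearing in exactly one $M_i$; $r$ is the number of layers, $\langle k_1,\dots,k_r\rangle$ the layer structure, and $a_{i_j}$ the canalizing input of $x_{i_j}$. Symmetry: for $i,j\in\{1,\dots,n\}$ write $i\sim_f j$ if $f$ is unchanged when $x_i$ and $x_j$ are swapped; this is an equivalence relation, and $f$ is $s$-symmetric if $\{1,\dots,n\}$ has exactly $s$ equivalence classes under $\sim_f$. $f$ is partially symmetric if some class has at least 2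 elements, i.e. $s\le n-1$. -}

module Defs where

open import Data.Bool using (Bool; true; false; not; _∧_; _xor_; if_then_else_)
open import Data.Bool.Properties using (_≟_)
open import Data.Nat using (ℕ; _≤_)
open import Data.Fin using (Fin)
open import Data.Fin.Permutation using (Permutation′; _⟨$⟩ʳ_; transpose)
open import Data.List using (List; []; _∷_; [_]; map; length; _++_; concatMap; allFin)
open import Data.List.Relation.Unary.All using (All)
open import Data.List.Relation.Binary.Permutation.Propositional using (_↭_)
open import Data.Product using (Σ; ∃; _×_; _,_; proj₁)
open import Function.Base using (_∘_)
open import Function.Definitions using (Surjective)
open import Relation.Binary.PropositionalEquality using (_≡_; _≢_)
open import Function.Bundles using (_⇔_)
open import Relation.Nullary using (does)

BoolFun : ℕ → Set
BoolFun n = (Fin n → Bool) → Bool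

-- Original definition of nested canalizing function (NCF).
-- `cascade` takes the list of triples (x_{σ(k)}, a_k, b_k) for k = 1..n
-- and returns b_k for the first k with x_{σ(k)} = a_k, and b_n ⊕ 1 if
-- there is no such k.

cascade : List (Bool × Bool × Bool) → Bool
cascade [] = false   -- never used (n ≥ 1 in all uses)
cascade ((v , a , b) ∷ []) = if does (v ≟ a) then b else not b
cascade ((v , a , b) ∷ t@(_ ∷ _)) = if does (v ≟ a) then b else cascade t

IsNCF : (n : ℕ) → BoolFun n → Set
IsNCF n f = Σ (Permutation′ n) λ σ → Σ (Fin n → Bool) λ a → Σ (Fin n → Bool) λ b →
  ∀ (x : Fin n → Bool) →
    f x ≡ cascade (map (λ k → (x (σ ⟨$⟩ʳ k) , a k , b k)) (allFin n))

-- Layer representation  f = M_1(M_2(⋯(M_{r-1}(M_r ⊕ 1) ⊕ 1)⋯) ⊕ 1) ⊕ b.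
-- A layer M_i is a list of (variable index, canalizing input a) pairs,
-- M_i(x) = ∏ (x_j ⊕ a_j).

Layer : ℕ → Set
Layer n = List (Fin n × Bool)

monomial : ∀ {n} → Layer n → (Fin n → Bool) → Bool
monomial [] x = true
monomial ((j , a) ∷ t) x = (x j xor a) ∧ monomial t x

nest : ∀ {n} → List (Layer n) → (Fin n → Bool) → Bool
nest [] x = false    -- never used (r ≥ 1)
nest (M ∷ []) x = monomial M x
nest (M ∷ Ms@(_ ∷ _)) x = monomial M x ∧ not (nest Ms x)

ValidLayerStructure : List ℕ → Set
ValidLayerStructure ks =
  Σ (List ℕ) λ ks′ → Σ ℕ λ kr → (ks ≡ ks′ ++ [ kr ]) × All (1 ≤_) ks′ × (2 ≤ kr)

-- f is written in the above form with layer structure ks: every variable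
-- occurs in exactly one layer (the variable indices of all layers form a
-- permutation of 0..n-1), layer i has k_i variables.
HasLayerStructure : (n : ℕ) → BoolFun n → List ℕ → Set
HasLayerStructure n f ks =
  ValidLayerStructure ks ×
  Σ (List (Layer n)) λ Ms → Σ Bool λ b →
      (map length Ms ≡ ks)
    × (concatMap (map proj₁) Ms ↭ allFin n)
    × (∀ (x : Fin n → Bool) → f x ≡ (nest Ms x xor b))

SymRel : ∀ {n} → BoolFun n → Fin n → Fin n → Set
SymRel f i j = ∀ x → f (x ∘ (transpose i j ⟨$⟩ʳ_)) ≡ f x

-- f is s-symmetric: exactly s equivalence classes under ∼_f, i.e. there is
-- a surjective labelling of {1..n} by Fin s whose fibres are the classes.
SSymmetric : ∀ {n} → BoolFun n → ℕ → Set
SSymmetric {n} f s = Σ (Fin n → Fin s) λ c →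
  Surjective _≡_ _≡_ c × (∀ i j → (c i ≡ c j) ⇔ SymRel f i j)

PartiallySymmetric : ∀ {n} → BoolFun n → Set
PartiallySymmetric {n} f = Σ (Fin n) λ i → Σ (Fin n) λ j → (i ≢ j) × SymRel f i j

-- Let d(x) be the index of the first layer whose monomial vanishes at x (r if none does);
-- the nested form reads f(x) = isOdd(d(x)) ⊕ b.  Every variable lies in exactly one layer
-- with one canalizing input, and transposing two variables that share both permutes the
-- factors of each layer monomial, so they are symmetric; of three variables in one layer
-- two share their canalizing input.  Conversely, let x_i lie in layer p and x_j in a later
-- layer.  Put x_i at its canalizing input, x_j at the opposite value, and keep every
-- other variable off its canalizing input except those of a chosen layer t; then d = p,
-- while after swapping x_i and x_j the first vanishing layer is t.  Taking t = p + 1 works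
-- unless layer p + 1 is {x_j} with a canalizing input different from that of x_i; such a
-- layer is not the last one, and t = p + 3 works.  The parities differ, so x_i ≁ x_j.
-- So each class lies in one layer and is a union of the (at most two) groups of that layer
-- sharing a canalizing input, whence r ≤ s ≤ 2r; and r ≤ n - 1 since the last layer has at
-- least two variables.

module Submission where

open import Defs
open import Data.Nat using (ℕ; _≤_; _∸_; _⊓_; ⌈_/2⌉)
open import Data.List using (List; length)
open import Data.List.Relation.Unary.Any using (Any)
open import Data.Product using (_×_)

open import Data.Bool using (Bool; true; false; not; _∧_; _xor_; if_then_else_)
open import Data.Bool.Properties using (not-involutive; not-¬; ¬-not; xor-same; ⇔→≡)
  renaming (_≟_ to _≟ᵇ_)
open import Data.Empty using (⊥-elim)
open import Data.Fin using (Fin; toℕ; fromℕ<; combine; _≟_)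
open import Data.Fin.Permutation using (transpose; _⟨$⟩ʳ_; _⟨$⟩ˡ_; inverseʳ)
open import Data.Fin.Properties
  using (any?; toℕ<n; toℕ-injective; fromℕ<-injective; injective⇒≤; combine-injective; 2↔Bool)
open import Data.List using ([]; _∷_; [_]; map; _++_; concatMap; allFin)
open import Data.List.Membership.Propositional using (_∈_)
open import Data.List.Membership.Propositional.Properties
  using (∈-++⁺ˡ; ∈-++⁺ʳ; ∈-++⁻; ∈-map⁺; ∈-map⁻; ∈-allFin)
open import Data.List.Properties
  using (∷-injective; ∷-injectiveˡ; ∷-injectiveʳ; length-map; length-++; length-tabulate)
open import Data.List.Relation.Binary.Disjoint.Propositional using (Disjoint)
open import Data.List.Relation.Binary.Permutation.Propositional using (_↭_; ↭-sym; ↭⇒↭ₛ)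
open import Data.List.Relation.Binary.Permutation.Propositional.Properties using (∈-resp-↭; ↭-length)
import Data.List.Relation.Binary.Permutation.Setoid.Properties as ↭ₛ
open import Data.List.Relation.Unary.All as All using (All; []; _∷_)
import Data.List.Relation.Unary.All.Properties as AllP
import Data.List.Relation.Unary.Any.Properties as AnyP
open import Data.List.Relation.Unary.Any using (here; there)
open import Data.List.Relation.Unary.AllPairs using ([]; _∷_)
open import Data.List.Relation.Unary.Unique.Propositional using (Unique)
open import Data.List.Relation.Unary.Unique.Propositional.Properties using (allFin⁺)
open import Data.Nat using (zero; suc; _<_; z≤n; s≤s; s≤s⁻¹; z<s; _+_; _*_)
open import Data.Nat.ListAction using (sum)
open import Data.Nat.Properties
  using (<⇒≤; <⇒≢; <⇒≱; <-trans; ≤-<-trans; <-cmp; n<1+n; m<n+m; +-mono-≤;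
         +-identityʳ; ⌈n/2⌉-mono; n≡⌈n+n/2⌉; suc[m]≤n⇒m≤pred[n]; ⊓-glb)
  renaming (_≟_ to _≟ℕ_)
open import Data.Product using (∃; ∃₂; _,_; proj₁; proj₂)
open import Data.Sum using (_⊎_; inj₁; inj₂)
open import Function.Base using (_∘_)
open import Function.Bundles using (Equivalence; Injection; mk⇔)
open import Function.Properties.Inverse using (↔-sym; Inverse⇒Injection)
open import Relation.Binary.Definitions using (tri<; tri≈; tri>)
open import Relation.Binary.PropositionalEquality
  using (_≡_; _≢_; refl; sym; trans; cong; cong₂; subst; setoid; module ≡-Reasoning)
open import Relation.Nullary using (¬_; yes; no; does; contradiction)
open import Relation.Nullary.Decidable using (dec-true; dec-false; _×-dec_; ¬?)

isOdd : ℕ → Bool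
isOdd zero    = false
isOdd (suc m) = not (isOdd m)

not-≢ : ∀ a → not a ≢ a
not-≢ a e = not-¬ refl (sym e)

isOdd-suc≢ : ∀ m → isOdd (suc m) ≢ isOdd m
isOdd-suc≢ m = not-≢ (isOdd m)

isOdd-3+≢ : ∀ m → isOdd (3 + m) ≢ isOdd m
isOdd-3+≢ m e = isOdd-suc≢ m (trans (sym (not-involutive (isOdd (suc m)))) e)

xor-cancelʳ : ∀ b {x y} → x xor b ≡ y xor b → x ≡ y
xor-cancelʳ b {false} {false} _ = refl
xor-cancelʳ b {true}  {true}  _ = refl
xor-cancelʳ b {false} {true}  e = contradiction e (not-¬ refl)
xor-cancelʳ b {true}  {false} e = contradiction (sym e) (not-¬ refl)

xor≡true⇒≢ : ∀ {x a} → x xor a ≡ true → x ≢ a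
xor≡true⇒≢ {x} e refl with () ← trans (sym (xor-same x)) e

≢⇒xor≡true : ∀ {x a} → x ≢ a → x xor a ≡ true
≢⇒xor≡true {false} {false} x≢a = contradiction refl x≢a
≢⇒xor≡true {false} {true}  _   = refl
≢⇒xor≡true {true}  {false} _   = refl
≢⇒xor≡true {true}  {true}  x≢a = contradiction refl x≢a

pigeonhole-Bool : (a b c : Bool) → a ≡ b ⊎ a ≡ c ⊎ b ≡ c
pigeonhole-Bool true  true  _     = inj₁ refl
pigeonhole-Bool false false _     = inj₁ refl
pigeonhole-Bool true  false true  = inj₂ (inj₁ refl)
pigeonhole-Bool false true  false = inj₂ (inj₁ refl)
pigeonhole-Bool true  false false = inj₂ (inj₂ refl)
pigeonhole-Bool false true  true  = inj₂ (inj₂ refl)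

⌈/2⌉≤ : ∀ {m} n → m ≤ 2 * n → ⌈ m /2⌉ ≤ n
⌈/2⌉≤ {m} n m≤2n = subst (⌈ m /2⌉ ≤_) (sym (n≡⌈n+n/2⌉ n))
  (⌈n/2⌉-mono (subst (m ≤_) (cong (n +_) (+-identityʳ n)) m≤2n))

Bool↣Fin2 : Injection (setoid Bool) (setoid (Fin 2))
Bool↣Fin2 = Inverse⇒Injection (↔-sym 2↔Bool)

module _ {n : ℕ} (i j : Fin n) where

  transpose-applyˡ : transpose i j ⟨$⟩ʳ i ≡ j
  transpose-applyˡ rewrite dec-true (i ≟ i) refl = refl

  transpose-applyʳ : transpose i j ⟨$⟩ʳ j ≡ i
  transpose-applyʳ with i ≟ j
  ... | yes i≡j rewrite dec-true (j ≟ i) (sym i≡j) = sym i≡j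
  ... | no  i≢j rewrite dec-false (j ≟ i) (i≢j ∘ sym) | dec-true (j ≟ j) refl = refl

  transpose-fix : ∀ {k} → k ≢ i → k ≢ j → transpose i j ⟨$⟩ʳ k ≡ k
  transpose-fix {k} k≢i k≢j rewrite dec-false (k ≟ i) k≢i | dec-false (k ≟ j) k≢j = refl

  transpose-invariant : ∀ {A : Set} (g : Fin n → A) → g i ≡ g j → ∀ k → g (transpose i j ⟨$⟩ʳ k) ≡ g k
  transpose-invariant g gi≡gj k with i ≟ k | j ≟ k
  ... | yes refl | _        = trans (cong g transpose-applyˡ) (sym gi≡gj)
  ... | no  _    | yes refl = trans (cong g transpose-applyʳ) gi≡gj
  ... | no  i≢k  | no  j≢k  = cong g (transpose-fix (i≢k ∘ sym) (j≢k ∘ sym))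

module _ {A : Set} where

  Unique-resp-↭ : ∀ {xs ys : List A} → xs ↭ ys → Unique xs → Unique ys
  Unique-resp-↭ p = ↭ₛ.Unique-resp-↭ (setoid A) (↭⇒↭ₛ p)

  Unique-++⁻ˡ : ∀ xs {ys : List A} → Unique (xs ++ ys) → Unique xs
  Unique-++⁻ˡ []       _        = []
  Unique-++⁻ˡ (x ∷ xs) (x∉ ∷ u) = AllP.++⁻ˡ xs x∉ ∷ Unique-++⁻ˡ xs u

  Unique-++⁻ʳ : ∀ xs {ys : List A} → Unique (xs ++ ys) → Unique ys
  Unique-++⁻ʳ []       u       = u
  Unique-++⁻ʳ (x ∷ xs) (_ ∷ u) = Unique-++⁻ʳ xs u

  Unique-++⇒Disjoint : ∀ xs {ys : List A} → Unique (xs ++ ys) → Disjoint xs ys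
  Unique-++⇒Disjoint (x ∷ xs) (x∉ ∷ _) (here refl , v∈ys) = All.lookup x∉ (∈-++⁺ʳ xs v∈ys) refl
  Unique-++⇒Disjoint (x ∷ xs) (_ ∷ u)  (there v∈xs , v∈ys) = Unique-++⇒Disjoint xs u (v∈xs , v∈ys)

  1≤length⇒∃∈ : ∀ {xs : List A} → 1 ≤ length xs → ∃ (_∈ xs)
  1≤length⇒∃∈ {x ∷ _} _ = x , here refl

module _ {K V : Set} where

  Unique-keys⇒functional : ∀ (M : List (K × V)) {k v v′} → Unique (map proj₁ M) →
                           (k , v) ∈ M → (k , v′) ∈ M → v ≡ v′
  Unique-keys⇒functional (_ ∷ M) _        (here refl) (here refl) = refl
  Unique-keys⇒functional (_ ∷ M) (k∉ ∷ _) (here refl) (there m′)  =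
    contradiction refl (All.lookup k∉ (∈-map⁺ proj₁ m′))
  Unique-keys⇒functional (_ ∷ M) (k∉ ∷ _) (there m)   (here refl) =
    contradiction refl (All.lookup k∉ (∈-map⁺ proj₁ m))
  Unique-keys⇒functional (_ ∷ M) (_ ∷ u)  (there m)   (there m′)  = Unique-keys⇒functional M u m m′

  Unique-keys⇒length≤1 : ∀ (M : List (K × V)) {k} → Unique (map proj₁ M) →
                         (∀ {k′ v} → (k′ , v) ∈ M → k′ ≡ k) → length M ≤ 1
  Unique-keys⇒length≤1 []          _                 _     = z≤n
  Unique-keys⇒length≤1 (_ ∷ [])    _                 _     = s≤s z≤n
  Unique-keys⇒length≤1 (_ ∷ _ ∷ _) ((k₁≢k₂ ∷ _) ∷ _) all≡k =
    contradiction (trans (all≡k (here refl)) (sym (all≡k (there (here refl))))) k₁≢k₂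

  layerAt : List (List (K × V)) → ℕ → List (K × V)
  layerAt []       _       = []
  layerAt (M ∷ Ms) zero    = M
  layerAt (M ∷ Ms) (suc q) = layerAt Ms q

  keys : List (List (K × V)) → List K
  keys = concatMap (map proj₁)

  length-keys : ∀ Ms → length (keys Ms) ≡ sum (map length Ms)
  length-keys []       = refl
  length-keys (M ∷ Ms) =
    trans (length-++ (map proj₁ M)) (cong₂ _+_ (length-map proj₁ M) (length-keys Ms))

  ∈-layerAt⇒∈-keys : ∀ Ms q {k v} → (k , v) ∈ layerAt Ms q → k ∈ keys Ms
  ∈-layerAt⇒∈-keys (M ∷ Ms) zero    m = ∈-++⁺ˡ (∈-map⁺ proj₁ m)
  ∈-layerAt⇒∈-keys (M ∷ Ms) (suc q) m = ∈-++⁺ʳ (map proj₁ M) (∈-layerAt⇒∈-keys Ms q m)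

  ∈-keys⇒∈-layerAt : ∀ Ms {k} → k ∈ keys Ms → ∃₂ λ q v → q < length Ms × (k , v) ∈ layerAt Ms q
  ∈-keys⇒∈-layerAt (M ∷ Ms) k∈ with ∈-++⁻ (map proj₁ M) k∈
  ... | inj₁ k∈M with (_ , v) , m , refl ← ∈-map⁻ proj₁ k∈M = zero , v , z<s , m
  ... | inj₂ k∈Ms with q , v , q< , m ← ∈-keys⇒∈-layerAt Ms k∈Ms = suc q , v , s≤s q< , m

  Unique-keys⇒layerAt-functional : ∀ Ms → Unique (keys Ms) → ∀ q q′ {k v v′} →
    (k , v) ∈ layerAt Ms q → (k , v′) ∈ layerAt Ms q′ → q ≡ q′ × v ≡ v′
  Unique-keys⇒layerAt-functional (M ∷ Ms) u zero zero m m′ =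
    refl , Unique-keys⇒functional M (Unique-++⁻ˡ (map proj₁ M) u) m m′
  Unique-keys⇒layerAt-functional (M ∷ Ms) u zero (suc q′) m m′ =
    ⊥-elim (Unique-++⇒Disjoint (map proj₁ M) u (∈-map⁺ proj₁ m , ∈-layerAt⇒∈-keys Ms q′ m′))
  Unique-keys⇒layerAt-functional (M ∷ Ms) u (suc q) zero m m′ =
    ⊥-elim (Unique-++⇒Disjoint (map proj₁ M) u (∈-map⁺ proj₁ m′ , ∈-layerAt⇒∈-keys Ms q m))
  Unique-keys⇒layerAt-functional (M ∷ Ms) u (suc q) (suc q′) m m′
    with q≡q′ , v≡v′ ← Unique-keys⇒layerAt-functional Ms (Unique-++⁻ʳ (map proj₁ M) u) q q′ m m′ =
    cong suc q≡q′ , v≡v′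

  Unique-keys⇒Unique-layerAt : ∀ Ms → Unique (keys Ms) → ∀ q → Unique (map proj₁ (layerAt Ms q))
  Unique-keys⇒Unique-layerAt []       _ _       = []
  Unique-keys⇒Unique-layerAt (M ∷ Ms) u zero    = Unique-++⁻ˡ (map proj₁ M) u
  Unique-keys⇒Unique-layerAt (M ∷ Ms) u (suc q) =
    Unique-keys⇒Unique-layerAt Ms (Unique-++⁻ʳ (map proj₁ M) u) q

  Any⇒∃layerAt : ∀ {P : List (K × V) → Set} {Ms} → Any P Ms → ∃ λ q → P (layerAt Ms q)
  Any⇒∃layerAt (here p)  = zero , p
  Any⇒∃layerAt (there a) with q , p ← Any⇒∃layerAt a = suc q , p

  data ValidLayers : List (List (K × V)) → Set where
    last : ∀ {M} → 2 ≤ length M → ValidLayers [ M ]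
    _∷_ : ∀ {M Ms} → 1 ≤ length M → ValidLayers Ms → ValidLayers (M ∷ Ms)

  validLayers : ∀ {Ms} → ValidLayerStructure (map length Ms) → ValidLayers Ms
  validLayers (ks′ , kr , lengths , positive , 2≤kr) = go ks′ lengths positive
    where
    go : ∀ ks′ {Ms} → map length Ms ≡ ks′ ++ [ kr ] → All (1 ≤_) ks′ → ValidLayers Ms
    go []        {M ∷ []}    lengths []
      with refl ← ∷-injectiveˡ lengths = last 2≤kr
    go []        {_ ∷ _ ∷ _} lengths [] with () ← ∷-injectiveʳ lengths
    go (k ∷ ks′) {M ∷ Ms}    lengths (1≤k ∷ positive)
      with refl , lengths′ ← ∷-injective lengths = 1≤k ∷ go ks′ lengths′ positive

  ValidLayers⇒nonempty : ∀ {Ms} → ValidLayers Ms → ∀ {q} → q < length Ms → 1 ≤ length (layerAt Ms q)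
  ValidLayers⇒nonempty (last 2≤) {zero}  _        = <⇒≤ 2≤
  ValidLayers⇒nonempty (1≤ ∷ _)  {zero}  _        = 1≤
  ValidLayers⇒nonempty (last _)  {suc _} (s≤s ())
  ValidLayers⇒nonempty (_ ∷ v)   {suc q} (s≤s q<) = ValidLayers⇒nonempty v q<

  ValidLayers⇒short-not-last : ∀ {Ms} → ValidLayers Ms → ∀ {q} →
    length (layerAt Ms q) ≤ 1 → q < length Ms → suc q < length Ms
  ValidLayers⇒short-not-last (last 2≤)     {zero}  ≤1 _        = contradiction ≤1 (<⇒≱ 2≤)
  ValidLayers⇒short-not-last (_ ∷ last _)  {zero}  _  _        = s≤s (s≤s z≤n)
  ValidLayers⇒short-not-last (_ ∷ (_ ∷ _)) {zero}  _  _        = s≤s (s≤s z≤n)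
  ValidLayers⇒short-not-last (last _)      {suc _} _  (s≤s ())
  ValidLayers⇒short-not-last (_ ∷ v)       {suc q} ≤1 (s≤s q<) = s≤s (ValidLayers⇒short-not-last v ≤1 q<)

  ValidLayers⇒length< : ∀ {Ms} → ValidLayers Ms → length Ms < sum (map length Ms)
  ValidLayers⇒length< (last 2≤) = subst (2 ≤_) (sym (+-identityʳ _)) 2≤
  ValidLayers⇒length< (1≤ ∷ v)  = +-mono-≤ 1≤ (ValidLayers⇒length< v)

module _ {n : ℕ} where

  monomial-true : ∀ (M : Layer n) x → (∀ {k a} → (k , a) ∈ M → x k ≢ a) → monomial M x ≡ true
  monomial-true []            x _     = refl
  monomial-true ((j , a) ∷ M) x unhit
    rewrite ≢⇒xor≡true (unhit (here refl)) = monomial-true M x (unhit ∘ there)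

  monomial-true⁻ : ∀ (M : Layer n) x → monomial M x ≡ true → ∀ {k a} → (k , a) ∈ M → x k ≢ a
  monomial-true⁻ ((j , a) ∷ M) x m≡true k∈ with x j xor a in e
  monomial-true⁻ ((j , a) ∷ M) x ()     _           | false
  monomial-true⁻ ((j , a) ∷ M) x m≡true (here refl) | true = xor≡true⇒≢ e
  monomial-true⁻ ((j , a) ∷ M) x m≡true (there k∈)  | true = monomial-true⁻ M x m≡true k∈

  monomial-false : ∀ (M : Layer n) x {k a} → (k , a) ∈ M → x k ≡ a → monomial M x ≡ false
  monomial-false M x k∈ hit = ¬-not λ m≡true → monomial-true⁻ M x m≡true k∈ hit

  monomial-cong : ∀ (M : Layer n) {x y} → (∀ k → x k ≡ y k) → monomial M x ≡ monomial M y
  monomial-cong []            _   = refl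
  monomial-cong ((j , a) ∷ M) x≗y = cong₂ _∧_ (cong (_xor a) (x≗y j)) (monomial-cong M x≗y)

  depth : List (Layer n) → (Fin n → Bool) → ℕ
  depth []       x = 0
  depth (M ∷ Ms) x = if monomial M x then suc (depth Ms x) else 0

  nest≡isOdd∘depth : ∀ Ms x → nest Ms x ≡ isOdd (depth Ms x)
  nest≡isOdd∘depth []                x = refl
  nest≡isOdd∘depth (M ∷ [])          x with monomial M x
  ... | true  = refl
  ... | false = refl
  nest≡isOdd∘depth (M ∷ M′ ∷ Ms)    x =
    trans (cong (λ v → monomial M x ∧ not v) (nest≡isOdd∘depth (M′ ∷ Ms) x))
          (∧-not-isOdd (monomial M x) (depth (M′ ∷ Ms) x))
    where
    ∧-not-isOdd : ∀ b d → b ∧ not (isOdd d) ≡ isOdd (if b then suc d else 0)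
    ∧-not-isOdd true  _ = refl
    ∧-not-isOdd false _ = refl

  depth-cong : ∀ Ms {x y} → (∀ q → monomial (layerAt Ms q) x ≡ monomial (layerAt Ms q) y) →
               depth Ms x ≡ depth Ms y
  depth-cong []       _       = refl
  depth-cong (M ∷ Ms) layers≡ =
    cong₂ (λ b d → if b then suc d else 0) (layers≡ zero) (depth-cong Ms (layers≡ ∘ suc))

  depth≡ : ∀ Ms x t → t ≤ length Ms →
           (∀ q → q < t → monomial (layerAt Ms q) x ≡ true) →
           (t < length Ms → monomial (layerAt Ms t) x ≡ false) →
           depth Ms x ≡ t
  depth≡ []       x zero    _        _       _     = refl
  depth≡ (M ∷ Ms) x zero    _        _       t-false rewrite t-false z<s = refl
  depth≡ (M ∷ Ms) x (suc t) (s≤s t≤) <t-true t-false rewrite <t-true zero z<s =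
    cong suc (depth≡ Ms x t t≤ (λ q q< → <t-true (suc q) (s≤s q<)) (t-false ∘ s≤s))

module NestedCanalizing {n : ℕ} (f : BoolFun n) (Ms : List (Layer n)) (b : Bool)
  (f≡ : ∀ x → f x ≡ (nest Ms x xor b))
  (keys↭ : keys Ms ↭ allFin n)
  (valid : ValidLayers Ms) where

  unique : Unique (keys Ms)
  unique = Unique-resp-↭ (↭-sym keys↭) (allFin⁺ n)

  position : ∀ i → ∃₂ λ q c → q < length Ms × (i , c) ∈ layerAt Ms q
  position i = ∈-keys⇒∈-layerAt Ms (∈-resp-↭ (↭-sym keys↭) (∈-allFin i))

  lay : Fin n → ℕ
  lay i = proj₁ (position i)

  can : Fin n → Bool
  can i = proj₁ (proj₂ (position i))

  lay< : ∀ i → lay i < length Ms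
  lay< i = proj₁ (proj₂ (proj₂ (position i)))

  ∈-layer : ∀ i → (i , can i) ∈ layerAt Ms (lay i)
  ∈-layer i = proj₂ (proj₂ (proj₂ (position i)))

  ∈-layer⁻ : ∀ {q k c} → (k , c) ∈ layerAt Ms q → lay k ≡ q × can k ≡ c
  ∈-layer⁻ {q} {k} = Unique-keys⇒layerAt-functional Ms unique (lay k) q (∈-layer k)

  layer-inhabited : ∀ {q} → q < length Ms → ∃ λ k → lay k ≡ q
  layer-inhabited {q} q<
    with (k , _) , m ← 1≤length⇒∃∈ {xs = layerAt Ms q} (ValidLayers⇒nonempty valid q<) =
    k , proj₁ (∈-layer⁻ m)

  lonely-layer-not-last : ∀ {q} j → (∀ k → lay k ≡ q → k ≡ j) → q < length Ms → suc q < length Ms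
  lonely-layer-not-last {q} j only-j = ValidLayers⇒short-not-last valid
    (Unique-keys⇒length≤1 (layerAt Ms q) (Unique-keys⇒Unique-layerAt Ms unique q)
      (λ m → only-j _ (proj₁ (∈-layer⁻ m))))

  layers<n : length Ms < n
  layers<n = subst (length Ms <_) sum≡n (ValidLayers⇒length< valid)
    where
    sum≡n : sum (map length Ms) ≡ n
    sum≡n = trans (sym (length-keys Ms)) (trans (↭-length keys↭) (length-tabulate (λ i → i)))

  layer-true : ∀ {q} x → (∀ k → lay k ≡ q → x k ≢ can k) → monomial (layerAt Ms q) x ≡ true
  layer-true x unhit = monomial-true _ x λ m →
    let lay≡ , can≡ = ∈-layer⁻ m in subst (x _ ≢_) can≡ (unhit _ lay≡)

  layer-true⁻ : ∀ {q} x → monomial (layerAt Ms q) x ≡ true → ∀ k → lay k ≡ q → x k ≢ can k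
  layer-true⁻ x m≡true k refl = monomial-true⁻ _ x m≡true (∈-layer k)

  layer-false : ∀ {q} x k → lay k ≡ q → x k ≡ can k → monomial (layerAt Ms q) x ≡ false
  layer-false x k refl = monomial-false _ x (∈-layer k)

  f≡isOdd∘depth : ∀ x → f x ≡ isOdd (depth Ms x) xor b
  f≡isOdd∘depth x = trans (f≡ x) (cong (_xor b) (nest≡isOdd∘depth Ms x))

  layer-true-∘ : ∀ (π : Fin n → Fin n) → (∀ k → lay (π k) ≡ lay k) → (∀ k → can (π k) ≡ can k) →
                 ∀ {q} x → monomial (layerAt Ms q) x ≡ true → monomial (layerAt Ms q) (x ∘ π) ≡ true
  layer-true-∘ π lay∘π can∘π x m≡true = layer-true (x ∘ π) λ k lay≡ →
    subst (x (π k) ≢_) (can∘π k) (layer-true⁻ x m≡true (π k) (trans (lay∘π k) lay≡))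

  sameLayer⇒SymRel : ∀ {i j} → lay i ≡ lay j → can i ≡ can j → SymRel f i j
  sameLayer⇒SymRel {i} {j} lay≡ can≡ x = begin
    f (x ∘ σ)                      ≡⟨ f≡isOdd∘depth (x ∘ σ) ⟩
    isOdd (depth Ms (x ∘ σ)) xor b ≡⟨ cong (λ d → isOdd d xor b) (depth-cong Ms layers≡) ⟩
    isOdd (depth Ms x) xor b       ≡⟨ f≡isOdd∘depth x ⟨
    f x                            ∎
    where
    open ≡-Reasoning
    σ σ⁻¹ : Fin n → Fin n
    σ   = transpose i j ⟨$⟩ʳ_
    σ⁻¹ = transpose i j ⟨$⟩ˡ_

    restore : ∀ {q} → monomial (layerAt Ms q) (x ∘ σ) ≡ true → monomial (layerAt Ms q) x ≡ true
    restore {q} h = trans (monomial-cong (layerAt Ms q) (λ k → cong x (sym (inverseʳ (transpose i j)))))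
      (layer-true-∘ σ⁻¹ (transpose-invariant j i lay (sym lay≡)) (transpose-invariant j i can (sym can≡))
                    (x ∘ σ) h)

    layers≡ : ∀ q → monomial (layerAt Ms q) (x ∘ σ) ≡ monomial (layerAt Ms q) x
    layers≡ q = ⇔→≡ (mk⇔ restore
      (layer-true-∘ σ (transpose-invariant i j lay lay≡) (transpose-invariant i j can can≡) x))

  SymRel⇒isOdd-depth≡ : ∀ {i j} → SymRel f i j → ∀ x →
                         isOdd (depth Ms (x ∘ (transpose i j ⟨$⟩ʳ_))) ≡ isOdd (depth Ms x)
  SymRel⇒isOdd-depth≡ i~j x = xor-cancelʳ b
    (trans (sym (f≡isOdd∘depth _)) (trans (i~j x) (f≡isOdd∘depth x)))

  module Probe {i j : Fin n} (i<j : lay i < lay j) (t : ℕ) where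

    i≢j : i ≢ j
    i≢j i≡j = <⇒≢ i<j (cong lay i≡j)

    probe : Fin n → Bool
    probe k = if does (k ≟ i) then can i
              else if does (k ≟ j) then not (can i)
              else if does (lay k ≟ℕ t) then can k
              else not (can k)

    swapped : Fin n → Bool
    swapped = probe ∘ (transpose i j ⟨$⟩ʳ_)

    probe-i : probe i ≡ can i
    probe-i rewrite dec-true (i ≟ i) refl = refl

    probe-j : probe j ≡ not (can i)
    probe-j rewrite dec-false (j ≟ i) (i≢j ∘ sym) | dec-true (j ≟ j) refl = refl

    probe-hit : ∀ {k} → k ≢ i → k ≢ j → lay k ≡ t → probe k ≡ can k
    probe-hit {k} k≢i k≢j lay≡t
      rewrite dec-false (k ≟ i) k≢i | dec-false (k ≟ j) k≢j | dec-true (lay k ≟ℕ t) lay≡t = refl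

    probe-miss : ∀ {k} → k ≢ i → k ≢ j → lay k ≢ t → probe k ≢ can k
    probe-miss {k} k≢i k≢j lay≢t
      rewrite dec-false (k ≟ i) k≢i | dec-false (k ≟ j) k≢j | dec-false (lay k ≟ℕ t) lay≢t =
      not-≢ (can k)

    swapped-i : swapped i ≡ not (can i)
    swapped-i = trans (cong probe (transpose-applyˡ i j)) probe-j

    swapped-j : swapped j ≡ can i
    swapped-j = trans (cong probe (transpose-applyʳ i j)) probe-i

    swapped-other : ∀ {k} → k ≢ i → k ≢ j → swapped k ≡ probe k
    swapped-other k≢i k≢j = cong probe (transpose-fix i j k≢i k≢j)

    depth-probe : lay i < t → depth Ms probe ≡ lay i
    depth-probe i<t =
      depth≡ Ms probe (lay i) (<⇒≤ (lay< i)) below (λ _ → layer-false probe i refl probe-i)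
      where
      below : ∀ q → q < lay i → monomial (layerAt Ms q) probe ≡ true
      below q q<i = layer-true probe λ k lay≡q → probe-miss
        (λ { refl → <⇒≢ q<i (sym lay≡q) })
        (λ { refl → <⇒≢ (<-trans q<i i<j) (sym lay≡q) })
        (λ lay≡t → <⇒≢ (<-trans q<i i<t) (trans (sym lay≡q) lay≡t))

    depth-swapped : lay i < t → t ≤ length Ms → (lay j < t → can i ≢ can j) →
                    (t < length Ms → ∃ λ k → lay k ≡ t × (k ≡ j → can i ≡ can j)) →
                    depth Ms swapped ≡ t
    depth-swapped i<t t≤ j-below hit-t = depth≡ Ms swapped t t≤ below at-t
      where
      unhit : ∀ k → lay k < t → swapped k ≢ can k
      unhit k k<t with i ≟ k | j ≟ k
      ... | yes refl | _        = subst (_≢ can k) (sym swapped-i) (not-≢ (can k))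
      ... | no  _    | yes refl = subst (_≢ can k) (sym swapped-j) (j-below k<t)
      ... | no  i≢k  | no  j≢k  = subst (_≢ can k) (sym (swapped-other (i≢k ∘ sym) (j≢k ∘ sym)))
                                    (probe-miss (i≢k ∘ sym) (j≢k ∘ sym) (<⇒≢ k<t))

      below : ∀ q → q < t → monomial (layerAt Ms q) swapped ≡ true
      below q q<t = layer-true swapped λ k lay≡q → unhit k (subst (_< t) (sym lay≡q) q<t)

      hit : ∀ k → lay k ≡ t → (k ≡ j → can i ≡ can j) → swapped k ≡ can k
      hit k lay≡t k≡j⇒ with j ≟ k
      ... | yes refl = trans swapped-j (k≡j⇒ refl)
      ... | no  j≢k  = trans (swapped-other k≢i (j≢k ∘ sym)) (probe-hit k≢i (j≢k ∘ sym) lay≡t)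
        where
        k≢i : k ≢ i
        k≢i refl = <⇒≢ i<t lay≡t

      at-t : t < length Ms → monomial (layerAt Ms t) swapped ≡ false
      at-t t< with k , lay≡t , k≡j⇒ ← hit-t t< = layer-false swapped k lay≡t (hit k lay≡t k≡j⇒)

    ¬SymRel : lay i < t → isOdd t ≢ isOdd (lay i) → t ≤ length Ms → (lay j < t → can i ≢ can j) →
              (t < length Ms → ∃ λ k → lay k ≡ t × (k ≡ j → can i ≡ can j)) → ¬ SymRel f i j
    ¬SymRel i<t parity≢ t≤ j-below hit-t i~j = parity≢ (begin
      isOdd t                  ≡⟨ cong isOdd (depth-swapped i<t t≤ j-below hit-t) ⟨
      isOdd (depth Ms swapped) ≡⟨ SymRel⇒isOdd-depth≡ i~j probe ⟩
      isOdd (depth Ms probe)   ≡⟨ cong isOdd (depth-probe i<t) ⟩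
      isOdd (lay i)            ∎)
      where open ≡-Reasoning

  ¬SymRel-via-next-layer : ∀ {i j} → lay i < lay j →
    (∃ λ k → lay k ≡ suc (lay i) × (k ≡ j → can i ≡ can j)) → ¬ SymRel f i j
  ¬SymRel-via-next-layer {i} {j} i<j witness = Probe.¬SymRel i<j (suc (lay i))
    (n<1+n (lay i)) (isOdd-suc≢ (lay i)) (<⇒≤ (≤-<-trans i<j (lay< j)))
    (λ j<sp → ⊥-elim (<⇒≱ i<j (s≤s⁻¹ j<sp))) (λ _ → witness)

  ¬SymRel-via-third-layer : ∀ {i j} → lay i < lay j → can i ≢ can j →
    (∀ k → lay k ≡ suc (lay i) → k ≡ j) → ¬ SymRel f i j
  ¬SymRel-via-third-layer {i} {j} i<j can≢ only-j = Probe.¬SymRel i<j (3 + lay i)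
    (m<n+m (lay i) z<s) (isOdd-3+≢ (lay i)) (lonely-layer-not-last j only-j sp<) (λ _ → can≢) witness
    where
    sp< : suc (lay i) < length Ms
    sp< = ≤-<-trans i<j (lay< j)

    lay-j : lay j ≡ suc (lay i)
    lay-j with k , lay≡ ← layer-inhabited sp< = subst (λ k → lay k ≡ suc (lay i)) (only-j k lay≡) lay≡

    witness : 3 + lay i < length Ms → ∃ λ k → lay k ≡ 3 + lay i × (k ≡ j → can i ≡ can j)
    witness 3+< with k , lay≡ ← layer-inhabited 3+< =
      k , lay≡ , λ { refl → ⊥-elim (<⇒≢ (m<n+m (suc (lay i)) {2} z<s) (trans (sym lay-j) lay≡)) }

  ¬SymRel-acrossLayers : ∀ {i j} → lay i < lay j → ¬ SymRel f i j
  ¬SymRel-acrossLayers {i} {j} i<j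
    with can i ≟ᵇ can j | any? (λ k → ¬? (k ≟ j) ×-dec (lay k ≟ℕ suc (lay i)))
  ... | yes can≡ | _ with k , lay≡ ← layer-inhabited (≤-<-trans i<j (lay< j)) =
    ¬SymRel-via-next-layer i<j (k , lay≡ , λ _ → can≡)
  ... | no _    | yes (k , k≢j , lay≡) = ¬SymRel-via-next-layer i<j (k , lay≡ , ⊥-elim ∘ k≢j)
  ... | no can≢ | no none = ¬SymRel-via-third-layer i<j can≢ only-j
    where
    only-j : ∀ k → lay k ≡ suc (lay i) → k ≡ j
    only-j k lay≡ with k ≟ j
    ... | yes k≡j = k≡j
    ... | no  k≢j = contradiction (k , k≢j , lay≡) none

  SymRel⇒sameLayer : ∀ {i j} → SymRel f i j → SymRel f j i → lay i ≡ lay j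
  SymRel⇒sameLayer {i} {j} i~j j~i with <-cmp (lay i) (lay j)
  ... | tri< i<j _ _ = contradiction i~j (¬SymRel-acrossLayers i<j)
  ... | tri≈ _ i≡j _ = i≡j
  ... | tri> _ _ j<i = contradiction j~i (¬SymRel-acrossLayers j<i)

  ∈-layerAt⇒SymRel : ∀ {q k k′ c} → (k , c) ∈ layerAt Ms q → (k′ , c) ∈ layerAt Ms q → SymRel f k k′
  ∈-layerAt⇒SymRel m m′ with lay≡ , can≡ ← ∈-layer⁻ m | lay≡′ , can≡′ ← ∈-layer⁻ m′ =
    sameLayer⇒SymRel (trans lay≡ (sym lay≡′)) (trans can≡ (sym can≡′))

  partiallySymmetric : ∀ q → 3 ≤ length (layerAt Ms q) → PartiallySymmetric f
  partiallySymmetric q 3≤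
    with layerAt Ms q | 3≤ | Unique-keys⇒Unique-layerAt Ms unique q | ∈-layerAt⇒SymRel {q}
  ... | _ ∷ []     | s≤s ()       | _ | _
  ... | _ ∷ _ ∷ [] | s≤s (s≤s ()) | _ | _
  ... | (k₁ , c₁) ∷ (k₂ , c₂) ∷ (k₃ , c₃) ∷ _ | _ | (k₁≢k₂ ∷ k₁≢k₃ ∷ _) ∷ (k₂≢k₃ ∷ _) ∷ _ | sym-if
    with pigeonhole-Bool c₁ c₂ c₃
  ... | inj₁ refl        = k₁ , k₂ , k₁≢k₂ , sym-if (here refl) (there (here refl))
  ... | inj₂ (inj₁ refl) = k₁ , k₃ , k₁≢k₃ , sym-if (here refl) (there (there (here refl)))
  ... | inj₂ (inj₂ refl) = k₂ , k₃ , k₂≢k₃ , sym-if (there (here refl)) (there (there (here refl)))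

  layers≤classes : ∀ {s} → SSymmetric f s → length Ms ≤ s
  layers≤classes (c , _ , c≡⇔) = injective⇒≤ {f = c ∘ representative} λ {t} {t′} c≡ →
    toℕ-injective (begin
      toℕ t                   ≡⟨ representative-lay t ⟨
      lay (representative t)  ≡⟨ SymRel⇒sameLayer (Equivalence.to (c≡⇔ _ _) c≡)
                                                  (Equivalence.to (c≡⇔ _ _) (sym c≡)) ⟩
      lay (representative t′) ≡⟨ representative-lay t′ ⟩
      toℕ t′                  ∎)
    where
    open ≡-Reasoning
    representative : Fin (length Ms) → Fin n
    representative t = proj₁ (layer-inhabited (toℕ<n t))
    representative-lay : ∀ t → lay (representative t) ≡ toℕ t
    representative-lay t = proj₂ (layer-inhabited (toℕ<n t))

  classes≤2*layers : ∀ {s} → SSymmetric f s → s ≤ 2 * length Ms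
  classes≤2*layers {s} (c , c-surjective , c≡⇔) = injective⇒≤ {f = label ∘ member} λ {t} {t′} label≡ →
    let can≡ , lay≡ = combine-injective _ _ _ _ label≡
        same = sameLayer⇒SymRel (fromℕ<-injective _ _ _ _ lay≡) (Injection.injective Bool↣Fin2 can≡)
    in trans (sym (c-member t)) (trans (Equivalence.from (c≡⇔ _ _) same) (c-member t′))
    where
    member : Fin s → Fin n
    member t = proj₁ (c-surjective t)
    c-member : ∀ t → c (member t) ≡ t
    c-member t = proj₂ (c-surjective t) refl
    label : Fin n → Fin (2 * length Ms)
    label k = combine (Injection.to Bool↣Fin2 (can k)) (fromℕ< (lay< k))

proposition4p7 : (n : ℕ) → 2 ≤ n → (f : BoolFun n) → IsNCF n f →
    (ks : List ℕ) → HasLayerStructure n f ks →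
      (Any (3 ≤_) ks → PartiallySymmetric f)
      × (∀ (s : ℕ) → SSymmetric f s →
           (⌈ s /2⌉ ≤ length ks) × (length ks ≤ (n ∸ 1) ⊓ s))
proposition4p7 n _ f _ ks (valid , Ms , b , lengths , keys↭ , f≡) = partial , bounds
  where
  open NestedCanalizing f Ms b f≡ keys↭ (validLayers (subst ValidLayerStructure (sym lengths) valid))

  r≡ : length Ms ≡ length ks
  r≡ = trans (sym (length-map length Ms)) (cong length lengths)

  partial : Any (3 ≤_) ks → PartiallySymmetric f
  partial big with q , 3≤ ← Any⇒∃layerAt (AnyP.map⁻ (subst (Any (3 ≤_)) (sym lengths) big)) =
    partiallySymmetric q 3≤

  bounds : ∀ s → SSymmetric f s → (⌈ s /2⌉ ≤ length ks) × (length ks ≤ (n ∸ 1) ⊓ s)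
  bounds s s-symmetric = subst (λ r → ⌈ s /2⌉ ≤ r × r ≤ (n ∸ 1) ⊓ s) r≡
    ( ⌈/2⌉≤ (length Ms) (classes≤2*layers s-symmetric)
    , ⊓-glb (suc[m]≤n⇒m≤pred[n] layers<n) (layers≤classes s-symmetric))
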